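{- Let $(\mathbf{R},\mathbb{I})$ be a realizer category. Then $\mathbf{PGAsm}(\mathbf{R},\mathbb{I})$ is weakly cartesian closed. Moreover, the weak exponentials can be chosen so that, for all objects $X,Y$, the weak exponential object $Y^X$ is modest whenever $Y$ is modest.
   Context: Let $\mathbf{R}$ be a cartesian closed category with terminal object $1$. An interval in $\mathbf{R}$ is an internal cogroupoid $\mathbb{I}$ with object of co-objects $1$: objects $\mathbb{I}_0=1,\mathbb{I}_1,\mathbb{I}_2,\mathbb{I}_3$ and maps $0,1:\mathbb{I}_0\to\mathbb{I}_1$, $*:\mathbb{I}_1\to\mathbb{I}_0$, $\sigma:\mathbb{I}_1\to\mathbb{I}_1$, $i_0,i_1,2:\mathbb{I}_1\to\mathbb{I}_2$, $j_0,j_1:\mathbb{I}_2\to\mathbb{I}_3$, such that $i_0\circ 1=i_1\circ 0$ exhibits $\mathbb{I}_2$ as the pushout of $1$ and $0$, $j_1\circ i_0=j_0\circ i_1$ exhibits $\mathbb{I}_3$ as the pushout of $i_0$ and $i_1$, and the cogroupoid axioms hold (equivalently: for each object $A$, the data below form a groupoid $\Pi A$). A realizer category $(\mathbf{R},\mathbb{I})$ is a cartesian closed category $\mathbf{R}$ with an interval $\mathbb{I}$. The fundamental groupoid $\Pi A$ has as objects the maps $a:\mathbb{I}_0\to A$; a morphism $\alpha:a\to b$ is a map $\alpha:\mathbb{I}_1\to A$ with $\alpha\circ 0=a$, $\alpha\circ 1=b$; the composite of $\alpha:a\to b$ and $\beta:b\to c$ is $[\beta,\alpha]\circ 2$, where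 $[\beta,\alpha]:\mathbb{I}_2\to A$ is the map with $[\beta,\alpha]i_0=\alpha$, $[\beta,\alpha]i_1=\beta$; identities are $a\circ *$ and inverses $\alpha\circ\sigma$. For $f:A\to B$, $\Pi(f):\Pi A\to\Pi B$ is postcomposition with $f$. A partitioned groupoidal assembly is a triple $(X,A,\Vert-\Vert_X)$ with $X$ a small groupoid, $A$ an object of $\mathbf{R}$ and $\Vert-\Vert_X:X\to\Pi A$ a functor; it is modest if $\Vert-\Vert_X$ is fully faithful. A morphism $(X,A,\Vert-\Vert_X)\to(Y,B,\Vert-\Vert_Y)$ is a functor $F:X\to Y$ for which there exist $e:A\to B$ in $\mathbf{R}$ and a natural isomorphism $\epsilon:\Pi(e)\circ\Vert-\Vert_X\Rightarrow\Vert-\Vert_Y\circ F$. Identities and composition are those of functors. This is the category $\mathbf{PGAsm}(\mathbf{R},\mathbb{I})$. A category is weakly cartesian closed if it has a terminal object and binary products and, for all objects $X,Y$, an object $Y^X$ with a morphism $\mathsf{ev}:Y^X\times X\to Y$ such that for every morphism $K:Z\times X\to Y$ there exists a (not necessarily unique) $\widetilde K:Z\to Y^X$ with $\mathsf{ev}\circ(\widetilde K\times X)=K$. -}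

module Defs where

open import Level using (Level; _⊔_; suc)
open import Relation.Binary using (Rel; IsEquivalence)
open import Relation.Binary.PropositionalEquality as P using (_≡_)
open import Data.Product using (Σ; _,_; proj₁; proj₂; Σ-syntax; _×_)

record Category (o ℓ e : Level) : Set (suc (o ⊔ ℓ ⊔ e)) where
  infix  4 _≈_
  infixr 9 _∘_
  field
    Obj : Set o
    Hom : Obj → Obj → Set ℓ
    _≈_ : ∀ {A B} → Rel (Hom A B) e
    id  : ∀ {A} → Hom A A
    _∘_ : ∀ {A B C} → Hom B C → Hom A B → Hom A C
    equiv     : ∀ {A B} → IsEquivalence (_≈_ {A} {B})
    assoc     : ∀ {A B C D} {f : Hom A B} {g : Hom B C} {h : Hom C D} →
                (h ∘ g) ∘ f ≈ h ∘ (g ∘ f)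
    identityˡ : ∀ {A B} {f : Hom A B} → id ∘ f ≈ f
    identityʳ : ∀ {A B} {f : Hom A B} → f ∘ id ≈ f
    ∘-resp-≈  : ∀ {A B C} {f h : Hom B C} {g i : Hom A B} →
                f ≈ h → g ≈ i → f ∘ g ≈ h ∘ i

  module Equiv {A B : Obj} = IsEquivalence (equiv {A} {B})

record Groupoid (o ℓ e : Level) : Set (suc (o ⊔ ℓ ⊔ e)) where
  field
    category : Category o ℓ e
  open Category category
  field
    _⁻¹      : ∀ {A B} → Hom A B → Hom B A
    inverseˡ : ∀ {A B} {f : Hom A B} → (f ⁻¹) ∘ f ≈ id
    inverseʳ : ∀ {A B} {f : Hom A B} → f ∘ (f ⁻¹) ≈ id

record Functor {o ℓ e o′ ℓ′ e′} (C : Category o ℓ e) (D : Category o′ ℓ′ e′)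
       : Set (o ⊔ ℓ ⊔ e ⊔ o′ ⊔ ℓ′ ⊔ e′) where
  private
    module C = Category C
    module D = Category D
  field
    F₀ : C.Obj → D.Obj
    F₁ : ∀ {A B} → C.Hom A B → D.Hom (F₀ A) (F₀ B)
    identity     : ∀ {A} → F₁ (C.id {A}) D.≈ D.id
    homomorphism : ∀ {A B C} {f : C.Hom A B} {g : C.Hom B C} →
                   F₁ (g C.∘ f) D.≈ F₁ g D.∘ F₁ f
    F-resp-≈     : ∀ {A B} {f g : C.Hom A B} → f C.≈ g → F₁ f D.≈ F₁ g

infixr 9 _∘F_
_∘F_ : ∀ {o ℓ e o′ ℓ′ e′ o″ ℓ″ e″}
         {C : Category o ℓ e} {D : Category o′ ℓ′ e′} {E : Category o″ ℓ″ e″} →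
       Functor D E → Functor C D → Functor C E
_∘F_ {E = E} G F = record
  { F₀ = λ x → G.F₀ (F.F₀ x)
  ; F₁ = λ f → G.F₁ (F.F₁ f)
  ; identity = E.Equiv.trans (G.F-resp-≈ F.identity) G.identity
  ; homomorphism = E.Equiv.trans (G.F-resp-≈ F.homomorphism) G.homomorphism
  ; F-resp-≈ = λ p → G.F-resp-≈ (F.F-resp-≈ p)
  }
  where
    module E = Category E
    module F = Functor F
    module G = Functor G

record NatIso {o ℓ e o′ ℓ′ e′} {C : Category o ℓ e} {D : Category o′ ℓ′ e′}
       (F G : Functor C D) : Set (o ⊔ ℓ ⊔ e ⊔ o′ ⊔ ℓ′ ⊔ e′) where
  private
    module C = Category C
    module D = Category D
    module F = Functor F
    module G = Functor G
  field
    η    : ∀ X → D.Hom (F.F₀ X) (G.F₀ X)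
    η⁻¹  : ∀ X → D.Hom (G.F₀ X) (F.F₀ X)
    isoˡ : ∀ {X} → η⁻¹ X D.∘ η X D.≈ D.id
    isoʳ : ∀ {X} → η X D.∘ η⁻¹ X D.≈ D.id
    commute : ∀ {X Y} (f : C.Hom X Y) → η Y D.∘ F.F₁ f D.≈ G.F₁ f D.∘ η X

record _≡F_ {o ℓ e o′ ℓ′ e′} {C : Category o ℓ e} {D : Category o′ ℓ′ e′}
       (F G : Functor C D) : Set (o ⊔ ℓ ⊔ e ⊔ o′ ⊔ ℓ′ ⊔ e′) where
  private
    module C = Category C
    module D = Category D
    module F = Functor F
    module G = Functor G
  field
    eq₀ : ∀ X → F.F₀ X ≡ G.F₀ X
    eq₁ : ∀ {X Y} (f : C.Hom X Y) →
          P.subst₂ D.Hom (eq₀ X) (eq₀ Y) (F.F₁ f) D.≈ G.F₁ f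

record FullyFaithful {o ℓ e o′ ℓ′ e′} {C : Category o ℓ e} {D : Category o′ ℓ′ e′}
       (F : Functor C D) : Set (o ⊔ ℓ ⊔ e ⊔ o′ ⊔ ℓ′ ⊔ e′) where
  private
    module C = Category C
    module D = Category D
    module F = Functor F
  field
    full     : ∀ {X Y} (g : D.Hom (F.F₀ X) (F.F₀ Y)) →
               Σ[ f ∈ C.Hom X Y ] F.F₁ f D.≈ g
    faithful : ∀ {X Y} (f g : C.Hom X Y) → F.F₁ f D.≈ F.F₁ g → f C.≈ g

module _ {o ℓ e} (C : Category o ℓ e) where
  open Category C

  record Terminal : Set (o ⊔ ℓ ⊔ e) where
    field
      ⊤   : Obj
      !   : ∀ {A} → Hom A ⊤
      !-unique : ∀ {A} (f : Hom A ⊤) → f ≈ !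

  record Product (A B : Obj) : Set (o ⊔ ℓ ⊔ e) where
    field
      A×B : Obj
      π₁  : Hom A×B A
      π₂  : Hom A×B B
      ⟨_,_⟩ : ∀ {Z} → Hom Z A → Hom Z B → Hom Z A×B
      project₁ : ∀ {Z} {f : Hom Z A} {g : Hom Z B} → π₁ ∘ ⟨ f , g ⟩ ≈ f
      project₂ : ∀ {Z} {f : Hom Z A} {g : Hom Z B} → π₂ ∘ ⟨ f , g ⟩ ≈ g
      unique   : ∀ {Z} {f : Hom Z A} {g : Hom Z B} (h : Hom Z A×B) →
                 π₁ ∘ h ≈ f → π₂ ∘ h ≈ g → h ≈ ⟨ f , g ⟩

  record IsPushout {X A B Q : Obj} (f : Hom X A) (g : Hom X B)
                   (inl : Hom A Q) (inr : Hom B Q) : Set (o ⊔ ℓ ⊔ e) where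
    field
      commute  : inl ∘ f ≈ inr ∘ g
      copair   : ∀ {Z} (h : Hom A Z) (k : Hom B Z) → h ∘ f ≈ k ∘ g → Hom Q Z
      copair-inl : ∀ {Z} {h : Hom A Z} {k : Hom B Z} {p : h ∘ f ≈ k ∘ g} →
                   copair h k p ∘ inl ≈ h
      copair-inr : ∀ {Z} {h : Hom A Z} {k : Hom B Z} {p : h ∘ f ≈ k ∘ g} →
                   copair h k p ∘ inr ≈ k
      unique   : ∀ {Z} {h : Hom A Z} {k : Hom B Z} {p : h ∘ f ≈ k ∘ g}
                 (u : Hom Q Z) → u ∘ inl ≈ h → u ∘ inr ≈ k → u ≈ copair h k p

  record CartesianClosed : Set (o ⊔ ℓ ⊔ e) where
    field
      terminal : Terminal
      product  : ∀ A B → Product A B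
    open Terminal terminal public
    module prod {A B} = Product (product A B)
    _×₀_ : Obj → Obj → Obj
    A ×₀ B = prod.A×B {A} {B}
    _×₁_ : ∀ {A B C D} → Hom A B → Hom C D → Hom (A ×₀ C) (B ×₀ D)
    f ×₁ g = prod.⟨ f ∘ prod.π₁ , g ∘ prod.π₂ ⟩
    field
      _^_   : Obj → Obj → Obj
      eval  : ∀ {A B} → Hom ((B ^ A) ×₀ A) B
      λg    : ∀ {A B C} → Hom (C ×₀ A) B → Hom C (B ^ A)
      β     : ∀ {A B C} {f : Hom (C ×₀ A) B} → eval ∘ (λg f ×₁ id) ≈ f
      λ-unique : ∀ {A B C} {f : Hom (C ×₀ A) B} (h : Hom C (B ^ A)) →
                 eval ∘ (h ×₁ id) ≈ f → h ≈ λg f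

-- The data of an interval (internal cogroupoid with co-object object 1),
-- together with the source/target axioms needed for the fundamental groupoid
-- operations to be well defined.
record IntervalData {o ℓ e} (R : Category o ℓ e) (ccc : CartesianClosed R)
       : Set (o ⊔ ℓ ⊔ e) where
  open Category R
  open CartesianClosed ccc using (⊤)
  I₀ : Obj
  I₀ = ⊤
  field
    I₁ I₂ I₃ : Obj
    0ᵢ 1ᵢ : Hom I₀ I₁
    *ᵢ    : Hom I₁ I₀
    σ     : Hom I₁ I₁
    i₀ i₁ 2ᵢ : Hom I₁ I₂
    j₀ j₁ : Hom I₂ I₃
    I₂-pushout : IsPushout R 1ᵢ 0ᵢ i₀ i₁
    I₃-pushout : IsPushout R i₀ i₁ j₁ j₀
    σ-0 : σ ∘ 0ᵢ ≈ 1ᵢ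
    σ-1 : σ ∘ 1ᵢ ≈ 0ᵢ
    2-0 : 2ᵢ ∘ 0ᵢ ≈ i₀ ∘ 0ᵢ
    2-1 : 2ᵢ ∘ 1ᵢ ≈ i₁ ∘ 1ᵢ

module ΠOps {o ℓ e} {R : Category o ℓ e} {ccc : CartesianClosed R}
            (ID : IntervalData R ccc) where
  open Category R
  open CartesianClosed ccc using (⊤; !; !-unique)
  open IntervalData ID
  private module PO = IsPushout I₂-pushout
  open Equiv

  record ΠHom (A : Obj) (a b : Hom I₀ A) : Set (ℓ ⊔ e) where
    constructor path
    field
      map : Hom I₁ A
      src : map ∘ 0ᵢ ≈ a
      tgt : map ∘ 1ᵢ ≈ b
  open ΠHom public

  _≈Π_ : ∀ {A a b} → Rel (ΠHom A a b) e
  α ≈Π β = map α ≈ map β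

  *-id : ∀ {c : Hom I₀ I₁} → *ᵢ ∘ c ≈ id
  *-id = trans (!-unique _) (sym (!-unique id))

  Πid : ∀ {A} {a : Hom I₀ A} → ΠHom A a a
  Πid {a = a} = path (a ∘ *ᵢ) (trans assoc (trans (∘-resp-≈ refl *-id) identityʳ))
                              (trans assoc (trans (∘-resp-≈ refl *-id) identityʳ))

  [_,_] : ∀ {A a b c} → ΠHom A b c → ΠHom A a b → Hom I₂ A
  [ β , α ] = PO.copair (map α) (map β) (trans (tgt α) (sym (src β)))

  _∘Π_ : ∀ {A a b c} → ΠHom A b c → ΠHom A a b → ΠHom A a c
  β ∘Π α = path ([ β , α ] ∘ 2ᵢ)
    (trans assoc (trans (∘-resp-≈ refl 2-0) (trans (sym assoc)
      (trans (∘-resp-≈ PO.copair-inl refl) (src α)))))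
    (trans assoc (trans (∘-resp-≈ refl 2-1) (trans (sym assoc)
      (trans (∘-resp-≈ PO.copair-inr refl) (tgt β)))))

  Πinv : ∀ {A a b} → ΠHom A a b → ΠHom A b a
  Πinv α = path (map α ∘ σ)
    (trans assoc (trans (∘-resp-≈ refl σ-0) (tgt α)))
    (trans assoc (trans (∘-resp-≈ refl σ-1) (src α)))

  ∘Π-resp : ∀ {A a b c} {β β′ : ΠHom A b c} {α α′ : ΠHom A a b} →
            β ≈Π β′ → α ≈Π α′ → (β ∘Π α) ≈Π (β′ ∘Π α′)
  ∘Π-resp {β = β} {β′} {α} {α′} p q = ∘-resp-≈ (PO.unique _
      (trans PO.copair-inl q) (trans PO.copair-inr p)) refl

  -- the cogroupoid axioms, in the equivalent form "Π A is a groupoid"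
  record ΠLaws : Set (o ⊔ ℓ ⊔ e) where
    field
      Π-assoc : ∀ {A a b c d} {α : ΠHom A a b} {β : ΠHom A b c} {γ : ΠHom A c d} →
                ((γ ∘Π β) ∘Π α) ≈Π (γ ∘Π (β ∘Π α))
      Π-identityˡ : ∀ {A a b} {α : ΠHom A a b} → (Πid ∘Π α) ≈Π α
      Π-identityʳ : ∀ {A a b} {α : ΠHom A a b} → (α ∘Π Πid) ≈Π α
      Π-inverseˡ  : ∀ {A a b} {α : ΠHom A a b} → (Πinv α ∘Π α) ≈Π Πid
      Π-inverseʳ  : ∀ {A a b} {α : ΠHom A a b} → (α ∘Π Πinv α) ≈Π Πid

record Interval {o ℓ e} (R : Category o ℓ e) (ccc : CartesianClosed R)
       : Set (o ⊔ ℓ ⊔ e) where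
  field
    intervalData : IntervalData R ccc
  open ΠOps intervalData public
  field
    laws : ΠLaws
  open ΠLaws laws public

record RealizerCategory (o ℓ e : Level) : Set (suc (o ⊔ ℓ ⊔ e)) where
  field
    R   : Category o ℓ e
    ccc : CartesianClosed R
    𝕀   : Interval R ccc

module Fundamental {o ℓ e} (RC : RealizerCategory o ℓ e) where
  open RealizerCategory RC
  open Category R
  open Interval 𝕀
  open IntervalData intervalData
  private module PO = IsPushout I₂-pushout
  open Equiv

  Π : Obj → Groupoid ℓ (ℓ ⊔ e) e
  Π A = record
    { category = record
      { Obj = Hom I₀ A
      ; Hom = ΠHom A
      ; _≈_ = _≈Π_
      ; id = Πid {A}
      ; _∘_ = _∘Π_
      ; equiv = record { refl = refl ; sym = sym ; trans = trans }
      ; assoc = λ {a b c d f g h} → Π-assoc {A} {a} {b} {c} {d} {f} {g} {h}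
      ; identityˡ = λ {a b f} → Π-identityˡ {A} {a} {b} {f}
      ; identityʳ = λ {a b f} → Π-identityʳ {A} {a} {b} {f}
      ; ∘-resp-≈ = λ {a b c f h g i} → ∘Π-resp {A} {a} {b} {c} {f} {h} {g} {i}
      }
    ; _⁻¹ = Πinv {A}
    ; inverseˡ = λ {a b f} → Π-inverseˡ {A} {a} {b} {f}
    ; inverseʳ = λ {a b f} → Π-inverseʳ {A} {a} {b} {f}
    }

  ΠC : Obj → Category ℓ (ℓ ⊔ e) e
  ΠC A = Groupoid.category (Π A)

  Πmap : ∀ {A B} → Hom A B → Functor (ΠC A) (ΠC B)
  Πmap {A} {B} f = record
    { F₀ = λ a → f ∘ a
    ; F₁ = λ α → path (f ∘ map α) (trans assoc (∘-resp-≈ refl (src α)))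
                                  (trans assoc (∘-resp-≈ refl (tgt α)))
    ; identity = sym assoc
    ; homomorphism = λ {_} {_} {_} {α} {β} →
        trans (sym assoc) (∘-resp-≈ (PO.unique _
          (trans assoc (∘-resp-≈ refl PO.copair-inl))
          (trans assoc (∘-resp-≈ refl PO.copair-inr))) refl)
    ; F-resp-≈ = λ p → ∘-resp-≈ refl p
    }

module PGAsm {o ℓ e} (c : Level) (RC : RealizerCategory o ℓ e) where
  open RealizerCategory RC
  open Category R using (Hom) renaming (Obj to RObj)
  open Fundamental RC public

  κ : Level
  κ = c ⊔ o ⊔ ℓ ⊔ e

  record Ob : Set (suc κ) where
    field
      X   : Groupoid κ κ κ
      A   : RObj
      ‖_‖ : Functor (Groupoid.category X) (ΠC A)
    Cat : Category κ κ κ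
    Cat = Groupoid.category X

  Modest : Ob → Set κ
  Modest 𝒳 = FullyFaithful (Ob.‖_‖ 𝒳)

  record Mor (𝒳 𝒴 : Ob) : Set κ where
    private
      module 𝒳 = Ob 𝒳
      module 𝒴 = Ob 𝒴
    field
      F : Functor 𝒳.Cat 𝒴.Cat
      tracker : Hom 𝒳.A 𝒴.A
      ε : NatIso (Πmap tracker ∘F 𝒳.‖_‖) (𝒴.‖_‖ ∘F F)

  -- Equality of morphisms is (strict) equality of the underlying functors,
  -- and composition is composition of the underlying functors.

  record TerminalObj : Set (suc κ) where
    field
      ⊤ : Ob
      ! : ∀ 𝒵 → Mor 𝒵 ⊤
      !-unique : ∀ 𝒵 (h : Mor 𝒵 ⊤) → Mor.F h ≡F Mor.F (! 𝒵)

  record BinaryProduct (𝒳 𝒴 : Ob) : Set (suc κ) where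
    field
      obj : Ob
      π₁  : Mor obj 𝒳
      π₂  : Mor obj 𝒴
      ⟨_,_⟩ : ∀ {𝒵} → Mor 𝒵 𝒳 → Mor 𝒵 𝒴 → Mor 𝒵 obj
      project₁ : ∀ {𝒵} (f : Mor 𝒵 𝒳) (g : Mor 𝒵 𝒴) →
                 (Mor.F π₁ ∘F Mor.F ⟨ f , g ⟩) ≡F Mor.F f
      project₂ : ∀ {𝒵} (f : Mor 𝒵 𝒳) (g : Mor 𝒵 𝒴) →
                 (Mor.F π₂ ∘F Mor.F ⟨ f , g ⟩) ≡F Mor.F g
      unique   : ∀ {𝒵} (f : Mor 𝒵 𝒳) (g : Mor 𝒵 𝒴) (h : Mor 𝒵 obj) →
                 (Mor.F π₁ ∘F Mor.F h) ≡F Mor.F f →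
                 (Mor.F π₂ ∘F Mor.F h) ≡F Mor.F g →
                 Mor.F h ≡F Mor.F ⟨ f , g ⟩

  -- weak exponential Y^X relative to chosen binary products.
  -- "ev ∘ (K̃ × X) = K", where K̃ × X is the (unique up to equality)
  -- morphism h with π₁ ∘ h = K̃ ∘ π₁ and π₂ ∘ h = π₂.
  record WeakExponential (prod : ∀ 𝒳 𝒴 → BinaryProduct 𝒳 𝒴) (𝒳 𝒴 : Ob)
         : Set (suc κ) where
    private
      _⊗_ : Ob → Ob → Ob
      𝒜 ⊗ ℬ = BinaryProduct.obj (prod 𝒜 ℬ)
      p₁ : ∀ {𝒜 ℬ} → Mor (𝒜 ⊗ ℬ) 𝒜
      p₁ {𝒜} {ℬ} = BinaryProduct.π₁ (prod 𝒜 ℬ)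
      p₂ : ∀ {𝒜 ℬ} → Mor (𝒜 ⊗ ℬ) ℬ
      p₂ {𝒜} {ℬ} = BinaryProduct.π₂ (prod 𝒜 ℬ)
    field
      obj   : Ob
      ev    : Mor (obj ⊗ 𝒳) 𝒴
      curry : ∀ {𝒵} → Mor (𝒵 ⊗ 𝒳) 𝒴 → Mor 𝒵 obj
      β     : ∀ {𝒵} (K : Mor (𝒵 ⊗ 𝒳) 𝒴) (h : Mor (𝒵 ⊗ 𝒳) (obj ⊗ 𝒳)) →
              (Mor.F (p₁ {obj} {𝒳}) ∘F Mor.F h) ≡F (Mor.F (curry K) ∘F Mor.F (p₁ {𝒵} {𝒳})) →
              (Mor.F (p₂ {obj} {𝒳}) ∘F Mor.F h) ≡F Mor.F (p₂ {𝒵} {𝒳}) →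
              (Mor.F ev ∘F Mor.F h) ≡F Mor.F K

  record WeaklyCartesianClosed : Set (suc κ) where
    field
      terminal : TerminalObj
      product  : ∀ 𝒳 𝒴 → BinaryProduct 𝒳 𝒴
      exponential : ∀ 𝒳 𝒴 → WeakExponential product 𝒳 𝒴

-- Terminal object and products are computed componentwise: the unit groupoid over 1, and the
-- product groupoid over A × B, realized by pairing paths.  The weak exponential of (X, A) and
-- (Y, B) lives over B^A.  Its objects are functors F : X → Y together with a point t of B^A and a
-- natural isomorphism τ between "evaluate t" and F on realizers; its morphisms are a path p in
-- B^A together with a natural transformation θ satisfying ‖θₓ‖ ∘ τₓ = τ′ₓ ∘ eval(p, ‖x‖).
-- Evaluation applies the functor, and K : Z × X → Y is curried to z ↦ K(z, -), realized by
-- λ-abstracting a realizer of K; the β-law then holds on the nose.  If ‖-‖ on Y is fully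
-- faithful, a morphism of the exponential is determined by p, and every path p arises: θₓ is the
-- preimage of τ′ₓ ∘ eval(p, ‖x‖) ∘ τₓ⁻¹, natural because each of the three factors is.
module Submission where

open import Defs
open import Level using (Level; _⊔_)
open import Data.Product using (Σ-syntax; _,_; proj₁; proj₂; _×_)
open import Data.Unit.Polymorphic using (tt) renaming (⊤ to Unit)
open import Relation.Binary using (Setoid)
import Relation.Binary.Reasoning.Setoid as SetoidReasoning
import Relation.Binary.PropositionalEquality as P
open P using (_≡_)

module CategoryProperties {o ℓ e} (C : Category o ℓ e) where
  open Category C
  open Equiv

  hom-setoid : Obj → Obj → Setoid ℓ e
  hom-setoid A B = record { Carrier = Hom A B ; _≈_ = _≈_ ; isEquivalence = equiv }

  module HomReasoning {A B : Obj} = SetoidReasoning (hom-setoid A B)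
  open HomReasoning

  paste-squares : ∀ {P Q R S T U} {f : Hom P Q} {a : Hom Q R} {b : Hom P S} {g : Hom S R}
                  {c : Hom R T} {d : Hom S U} {h : Hom U T} →
                  a ∘ f ≈ g ∘ b → c ∘ g ≈ h ∘ d → (c ∘ a) ∘ f ≈ h ∘ (d ∘ b)
  paste-squares {f = f} {a} {b} {g} {c} {d} {h} sq₁ sq₂ = begin
    (c ∘ a) ∘ f  ≈⟨ assoc ⟩
    c ∘ (a ∘ f)  ≈⟨ ∘-resp-≈ refl sq₁ ⟩
    c ∘ (g ∘ b)  ≈⟨ sym assoc ⟩
    (c ∘ g) ∘ b  ≈⟨ ∘-resp-≈ sq₂ refl ⟩
    (h ∘ d) ∘ b  ≈⟨ assoc ⟩
    h ∘ (d ∘ b)  ∎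

  middle-square : ∀ {P Q R S T U} {f : Hom P Q} {a : Hom Q R} {b : Hom Q S} {g : Hom R T}
                  {c : Hom S T} {h : Hom T U} →
                  g ∘ a ≈ c ∘ b → (h ∘ g) ∘ (a ∘ f) ≈ (h ∘ c) ∘ (b ∘ f)
  middle-square {f = f} {a} {b} {g} {c} {h} sq = begin
    (h ∘ g) ∘ (a ∘ f)  ≈⟨ assoc ⟩
    h ∘ (g ∘ (a ∘ f))  ≈⟨ ∘-resp-≈ refl (sym assoc) ⟩
    h ∘ ((g ∘ a) ∘ f)  ≈⟨ ∘-resp-≈ refl (∘-resp-≈ sq refl) ⟩
    h ∘ ((c ∘ b) ∘ f)  ≈⟨ ∘-resp-≈ refl assoc ⟩
    h ∘ (c ∘ (b ∘ f))  ≈⟨ sym assoc ⟩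
    (h ∘ c) ∘ (b ∘ f)  ∎

module GroupoidProperties {o ℓ e} (G : Groupoid o ℓ e) where
  open Groupoid G
  open Category category
  open Equiv
  open CategoryProperties category public

  cancelʳ : ∀ {A B D} {f : Hom A B} {h k : Hom B D} → h ∘ f ≈ k ∘ f → h ≈ k
  cancelʳ {f = f} {h} {k} eq = begin
    h               ≈⟨ sym identityʳ ⟩
    h ∘ id          ≈⟨ ∘-resp-≈ refl (sym inverseʳ) ⟩
    h ∘ (f ∘ f ⁻¹)  ≈⟨ sym assoc ⟩
    (h ∘ f) ∘ f ⁻¹  ≈⟨ ∘-resp-≈ eq refl ⟩
    (k ∘ f) ∘ f ⁻¹  ≈⟨ assoc ⟩
    k ∘ (f ∘ f ⁻¹)  ≈⟨ ∘-resp-≈ refl inverseʳ ⟩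
    k ∘ id          ≈⟨ identityʳ ⟩
    k               ∎
    where open HomReasoning

  inverse-unique : ∀ {A B} {f : Hom A B} {g : Hom B A} → g ∘ f ≈ id → g ≈ f ⁻¹
  inverse-unique eq = cancelʳ (trans eq (sym inverseˡ))

  inverse-cancelʳ : ∀ {A B C D} {f : Hom A B} {k : Hom A C} {h : Hom C D} → (h ∘ (k ∘ f ⁻¹)) ∘ f ≈ h ∘ k
  inverse-cancelʳ {f = f} {k} {h} = begin
    (h ∘ (k ∘ f ⁻¹)) ∘ f  ≈⟨ assoc ⟩
    h ∘ ((k ∘ f ⁻¹) ∘ f)  ≈⟨ ∘-resp-≈ refl assoc ⟩
    h ∘ (k ∘ (f ⁻¹ ∘ f))  ≈⟨ ∘-resp-≈ refl (∘-resp-≈ refl inverseˡ) ⟩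
    h ∘ (k ∘ id)          ≈⟨ ∘-resp-≈ refl identityʳ ⟩
    h ∘ k                 ∎
    where open HomReasoning

  inverse-square : ∀ {A B C D} {f : Hom A B} {h : Hom B C} {g : Hom A D} {k : Hom D C} →
                   h ∘ f ≈ k ∘ g → h ⁻¹ ∘ k ≈ f ∘ g ⁻¹
  inverse-square {f = f} {h} {g} {k} sq = cancelʳ (begin
    (h ⁻¹ ∘ k) ∘ g      ≈⟨ assoc ⟩
    h ⁻¹ ∘ (k ∘ g)      ≈⟨ ∘-resp-≈ refl (sym sq) ⟩
    h ⁻¹ ∘ (h ∘ f)      ≈⟨ sym assoc ⟩
    (h ⁻¹ ∘ h) ∘ f      ≈⟨ ∘-resp-≈ inverseˡ refl ⟩
    id ∘ f              ≈⟨ identityˡ ⟩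
    f                   ≈⟨ sym identityʳ ⟩
    f ∘ id              ≈⟨ ∘-resp-≈ refl (sym inverseˡ) ⟩
    f ∘ (g ⁻¹ ∘ g)      ≈⟨ sym assoc ⟩
    (f ∘ g ⁻¹) ∘ g      ∎)
    where open HomReasoning

F₁-inverse : ∀ {o ℓ e o′ ℓ′ e′} {G : Groupoid o ℓ e} {H : Groupoid o′ ℓ′ e′}
             (F : Functor (Groupoid.category G) (Groupoid.category H)) →
             ∀ {A B} {f : Category.Hom (Groupoid.category G) A B} →
             Category._≈_ (Groupoid.category H) (Functor.F₁ F (Groupoid._⁻¹ G f))
                                                (Groupoid._⁻¹ H (Functor.F₁ F f))
F₁-inverse {G = G} {H} F = GroupoidProperties.inverse-unique H
  (trans (sym homomorphism) (trans (F-resp-≈ (Groupoid.inverseˡ G)) identity))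
  where
    open Functor F
    open Category.Equiv (Groupoid.category H)

module _ {a r} {A : Set a} (_∼_ : A → A → Set r) where

  subst₂-trans : ∀ {x y z u v w} (p : x ≡ y) (q : y ≡ z) (p′ : u ≡ v) (q′ : v ≡ w) (t : x ∼ u) →
                 P.subst₂ _∼_ (P.trans p q) (P.trans p′ q′) t ≡ P.subst₂ _∼_ q q′ (P.subst₂ _∼_ p p′ t)
  subst₂-trans P.refl q P.refl q′ t = P.refl

  subst₂-map : ∀ {a′ r′} {A′ : Set a′} (_∼′_ : A′ → A′ → Set r′) (f₀ : A → A′)
               (f₁ : ∀ {x y} → x ∼ y → f₀ x ∼′ f₀ y) {x y u v} (p : x ≡ y) (q : u ≡ v) (t : x ∼ u) →
               P.subst₂ _∼′_ (P.cong f₀ p) (P.cong f₀ q) (f₁ t) ≡ f₁ (P.subst₂ _∼_ p q t)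
  subst₂-map _∼′_ f₀ f₁ P.refl P.refl t = P.refl

  subst₂-× : ∀ {a′ r′} {A′ : Set a′} (_∼′_ : A′ → A′ → Set r′)
             {x y u v x′ y′ u′ v′} (p : x ≡ y) (p′ : x′ ≡ y′) (q : u ≡ v) (q′ : u′ ≡ v′)
             (t : x ∼ u) (t′ : x′ ∼′ u′) →
             P.subst₂ (λ s s′ → (proj₁ s ∼ proj₁ s′) × (proj₂ s ∼′ proj₂ s′))
                      (P.cong₂ _,_ p p′) (P.cong₂ _,_ q q′) (t , t′)
             ≡ (P.subst₂ _∼_ p q t , P.subst₂ _∼′_ p′ q′ t′)
  subst₂-× _∼′_ P.refl P.refl P.refl P.refl t t′ = P.refl

module _ {o ℓ e o′ ℓ′ e′} {C : Category o ℓ e} {D : Category o′ ℓ′ e′} where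
  private
    module D = Category D

  subst₂-resp-≈ : ∀ {X X′ Y Y′} (p : X ≡ X′) (q : Y ≡ Y′) {f g : D.Hom X Y} →
                  f D.≈ g → P.subst₂ D.Hom p q f D.≈ P.subst₂ D.Hom p q g
  subst₂-resp-≈ P.refl P.refl eq = eq

  ≡F-trans : {F G H : Functor C D} → F ≡F G → G ≡F H → F ≡F H
  ≡F-trans {F} {G} {H} F≡G G≡H = record
    { eq₀ = λ X → P.trans (F≡G.eq₀ X) (G≡H.eq₀ X)
    ; eq₁ = λ {X} {Y} f → D.Equiv.trans
        (D.Equiv.reflexive (subst₂-trans D.Hom (F≡G.eq₀ X) (G≡H.eq₀ X) (F≡G.eq₀ Y) (G≡H.eq₀ Y) (Functor.F₁ F f)))
        (D.Equiv.trans (subst₂-resp-≈ (G≡H.eq₀ X) (G≡H.eq₀ Y) (F≡G.eq₁ f)) (G≡H.eq₁ f))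
    }
    where
      module F≡G = _≡F_ F≡G
      module G≡H = _≡F_ G≡H

  ∘F-resp-≡F : ∀ {o″ ℓ″ e″} {E : Category o″ ℓ″ e″} (F : Functor D E) {G H : Functor C D} →
               G ≡F H → (F ∘F G) ≡F (F ∘F H)
  ∘F-resp-≡F {E = E} F {G} G≡H = record
    { eq₀ = λ X → P.cong F₀ (G≡H.eq₀ X)
    ; eq₁ = λ {X} {Y} f → Category.Equiv.trans E
        (Category.Equiv.reflexive E (subst₂-map D.Hom (Category.Hom E) F₀ F₁ (G≡H.eq₀ X) (G≡H.eq₀ Y) (Functor.F₁ G f)))
        (F-resp-≈ (G≡H.eq₁ f))
    }
    where
      open Functor F
      module G≡H = _≡F_ G≡H

module _ {o ℓ e o′ ℓ′ e′ : Level} where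

  _×C_ : Category o ℓ e → Category o′ ℓ′ e′ → Category (o ⊔ o′) (ℓ ⊔ ℓ′) (e ⊔ e′)
  C ×C D = record
    { Obj = C.Obj × D.Obj
    ; Hom = λ X Y → C.Hom (proj₁ X) (proj₁ Y) × D.Hom (proj₂ X) (proj₂ Y)
    ; _≈_ = λ f g → (proj₁ f C.≈ proj₁ g) × (proj₂ f D.≈ proj₂ g)
    ; id = C.id , D.id
    ; _∘_ = λ f g → (proj₁ f C.∘ proj₁ g) , (proj₂ f D.∘ proj₂ g)
    ; equiv = record
      { refl = C.Equiv.refl , D.Equiv.refl
      ; sym = λ eq → C.Equiv.sym (proj₁ eq) , D.Equiv.sym (proj₂ eq)
      ; trans = λ eq eq′ → C.Equiv.trans (proj₁ eq) (proj₁ eq′) , D.Equiv.trans (proj₂ eq) (proj₂ eq′)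
      }
    ; assoc = C.assoc , D.assoc
    ; identityˡ = C.identityˡ , D.identityˡ
    ; identityʳ = C.identityʳ , D.identityʳ
    ; ∘-resp-≈ = λ eq eq′ → C.∘-resp-≈ (proj₁ eq) (proj₁ eq′) , D.∘-resp-≈ (proj₂ eq) (proj₂ eq′)
    }
    where
      module C = Category C
      module D = Category D

  _×G_ : Groupoid o ℓ e → Groupoid o′ ℓ′ e′ → Groupoid (o ⊔ o′) (ℓ ⊔ ℓ′) (e ⊔ e′)
  G ×G H = record
    { category = G.category ×C H.category
    ; _⁻¹ = λ f → proj₁ f G.⁻¹ , proj₂ f H.⁻¹
    ; inverseˡ = G.inverseˡ , H.inverseˡ
    ; inverseʳ = G.inverseʳ , H.inverseʳ
    }
    where
      module G = Groupoid G
      module H = Groupoid H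

  module _ {C : Category o ℓ e} {D : Category o′ ℓ′ e′} where
    private
      module C = Category C
      module D = Category D

    π₁F : Functor (C ×C D) C
    π₁F = record
      { F₀ = proj₁ ; F₁ = proj₁ ; identity = C.Equiv.refl ; homomorphism = C.Equiv.refl ; F-resp-≈ = proj₁ }

    π₂F : Functor (C ×C D) D
    π₂F = record
      { F₀ = proj₂ ; F₁ = proj₂ ; identity = D.Equiv.refl ; homomorphism = D.Equiv.refl ; F-resp-≈ = proj₂ }

    module _ {o″ ℓ″ e″} {E : Category o″ ℓ″ e″} where

      ⟨_,_⟩F : Functor E C → Functor E D → Functor E (C ×C D)
      ⟨ F , G ⟩F = record
        { F₀ = λ X → F.F₀ X , G.F₀ X
        ; F₁ = λ f → F.F₁ f , G.F₁ f
        ; identity = F.identity , G.identity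
        ; homomorphism = F.homomorphism , G.homomorphism
        ; F-resp-≈ = λ eq → F.F-resp-≈ eq , G.F-resp-≈ eq
        }
        where
          module F = Functor F
          module G = Functor G

      π₁F∘⟨⟩F : (F : Functor E C) (G : Functor E D) → (π₁F ∘F ⟨ F , G ⟩F) ≡F F
      π₁F∘⟨⟩F F G = record { eq₀ = λ _ → P.refl ; eq₁ = λ _ → C.Equiv.refl }

      π₂F∘⟨⟩F : (F : Functor E C) (G : Functor E D) → (π₂F ∘F ⟨ F , G ⟩F) ≡F G
      π₂F∘⟨⟩F F G = record { eq₀ = λ _ → P.refl ; eq₁ = λ _ → D.Equiv.refl }

      ⟨⟩F-unique : {F : Functor E C} {G : Functor E D} (H : Functor E (C ×C D)) →
                   (π₁F ∘F H) ≡F F → (π₂F ∘F H) ≡F G → H ≡F ⟨ F , G ⟩F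
      ⟨⟩F-unique {F} {G} H π₁H≡F π₂H≡G = record
        { eq₀ = λ X → P.cong₂ _,_ (π₁H≡F.eq₀ X) (π₂H≡G.eq₀ X)
        ; eq₁ = λ {X} {Y} f → Category.Equiv.trans (C ×C D)
            (Category.Equiv.reflexive (C ×C D)
              (subst₂-× C.Hom D.Hom (π₁H≡F.eq₀ X) (π₂H≡G.eq₀ X) (π₁H≡F.eq₀ Y) (π₂H≡G.eq₀ Y)
                        (proj₁ (Functor.F₁ H f)) (proj₂ (Functor.F₁ H f))))
            (π₁H≡F.eq₁ f , π₂H≡G.eq₁ f)
        }
        where
          module π₁H≡F = _≡F_ π₁H≡F
          module π₂H≡G = _≡F_ π₂H≡G

unit-groupoid : ∀ {o ℓ e} → Groupoid o ℓ e
unit-groupoid = record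
  { category = record
    { Obj = Unit ; Hom = λ _ _ → Unit ; _≈_ = λ _ _ → Unit ; id = tt ; _∘_ = λ _ _ → tt
    ; equiv = record { refl = tt ; sym = λ _ → tt ; trans = λ _ _ → tt }
    ; assoc = tt ; identityˡ = tt ; identityʳ = tt ; ∘-resp-≈ = λ _ _ → tt
    }
  ; _⁻¹ = λ _ → tt ; inverseˡ = tt ; inverseʳ = tt
  }

module RealizerProperties {o ℓ e} (RC : RealizerCategory o ℓ e) where
  open RealizerCategory RC
  open Category R
  open Equiv
  open CategoryProperties R
  open CartesianClosed ccc renaming (⊤ to 𝟙; β to λg-β)
  open Interval 𝕀
  open IntervalData intervalData
  open Fundamental RC
  private
    module PO = IsPushout I₂-pushout

  !-unique₂ : ∀ {A} (f g : Hom A 𝟙) → f ≈ g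
  !-unique₂ f g = trans (!-unique f) (sym (!-unique g))

  module _ {A B : Obj} where
    open Product (product A B)

    ⟨⟩∘ : ∀ {Z W} {f : Hom Z A} {g : Hom Z B} {h : Hom W Z} → ⟨ f , g ⟩ ∘ h ≈ ⟨ f ∘ h , g ∘ h ⟩
    ⟨⟩∘ = unique _ (trans (sym assoc) (∘-resp-≈ project₁ refl)) (trans (sym assoc) (∘-resp-≈ project₂ refl))

    ⟨⟩-cong₂ : ∀ {Z} {f f′ : Hom Z A} {g g′ : Hom Z B} → f ≈ f′ → g ≈ g′ → ⟨ f , g ⟩ ≈ ⟨ f′ , g′ ⟩
    ⟨⟩-cong₂ eq eq′ = unique _ (trans project₁ eq) (trans project₂ eq′)

  eval-λg-pointwise : ∀ {A B C Z} {k : Hom (C ×₀ A) B} {c : Hom Z C} {a : Hom Z A} →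
                      eval ∘ prod.⟨ λg k ∘ c , a ⟩ ≈ k ∘ prod.⟨ c , a ⟩
  eval-λg-pointwise {A} {B} {C} {k = k} {c} {a} = begin
    eval ∘ prod.⟨ λg k ∘ c , a ⟩                 ≈⟨ ∘-resp-≈ refl (⟨⟩-cong₂ refl (sym identityˡ)) ⟩
    eval ∘ prod.⟨ λg k ∘ c , id ∘ a ⟩            ≈⟨ ∘-resp-≈ refl (sym ×₁∘⟨⟩) ⟩
    eval ∘ ((λg k ×₁ id) ∘ prod.⟨ c , a ⟩)       ≈⟨ sym assoc ⟩
    (eval ∘ (λg k ×₁ id)) ∘ prod.⟨ c , a ⟩       ≈⟨ ∘-resp-≈ λg-β refl ⟩
    k ∘ prod.⟨ c , a ⟩                           ∎
    where
      open HomReasoning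
      ×₁∘⟨⟩ : (λg k ×₁ id) ∘ prod.⟨ c , a ⟩ ≈ prod.⟨ λg k ∘ c , id ∘ a ⟩
      ×₁∘⟨⟩ = trans ⟨⟩∘ (⟨⟩-cong₂ (trans assoc (∘-resp-≈ refl prod.project₁))
                                  (trans assoc (∘-resp-≈ refl prod.project₂)))

  -- Paths are compared by their underlying maps, so endpoints may differ.  Unlike _≈Π_, this
  -- relation is indexed by the paths themselves, so Agda can infer them from an equation.
  infix 4 _≃_
  record _≃_ {A a b a′ b′} (α : ΠHom A a b) (β : ΠHom A a′ b′) : Set e where
    constructor mk≃
    field
      maps-≈ : map α ≈ map β
  open _≃_ public

  module _ {A a b} {α : ΠHom A a b} where

    ≃-refl : α ≃ α
    ≃-refl = mk≃ refl

    ≃-sym : ∀ {a′ b′} {β : ΠHom A a′ b′} → α ≃ β → β ≃ α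
    ≃-sym eq = mk≃ (sym (maps-≈ eq))

    ≃-trans : ∀ {a′ b′ a″ b″} {β : ΠHom A a′ b′} {γ : ΠHom A a″ b″} → α ≃ β → β ≃ γ → α ≃ γ
    ≃-trans eq eq′ = mk≃ (trans (maps-≈ eq) (maps-≈ eq′))

  module ≃-Reasoning where
    infix  1 begin_
    infixr 2 _≃⟨_⟩_ _≃˘⟨_⟩_
    infix  3 _∎

    begin_ : ∀ {A a b a′ b′} {α : ΠHom A a b} {β : ΠHom A a′ b′} → α ≃ β → α ≃ β
    begin eq = eq

    _≃⟨_⟩_ : ∀ {A a b a′ b′ a″ b″} (α : ΠHom A a b) {β : ΠHom A a′ b′} {γ : ΠHom A a″ b″} →
             α ≃ β → β ≃ γ → α ≃ γ
    _ ≃⟨ eq ⟩ eq′ = ≃-trans eq eq′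

    _≃˘⟨_⟩_ : ∀ {A a b a′ b′ a″ b″} (α : ΠHom A a b) {β : ΠHom A a′ b′} {γ : ΠHom A a″ b″} →
              β ≃ α → β ≃ γ → α ≃ γ
    _ ≃˘⟨ eq ⟩ eq′ = ≃-trans (≃-sym eq) eq′

    _∎ : ∀ {A a b} (α : ΠHom A a b) → α ≃ α
    _ ∎ = ≃-refl

  -- Unifying through the transparent _∘Π_ unfolds the endpoint proofs of nested composites,
  -- which is exponentially slow in the nesting depth.
  opaque
    infixr 9 _⊙_
    _⊙_ : ∀ {A a b c} → ΠHom A b c → ΠHom A a b → ΠHom A a c
    _⊙_ = _∘Π_

  opaque
    unfolding _⊙_

    ⊙≃∘Π : ∀ {A a b c} {β : ΠHom A b c} {α : ΠHom A a b} → (β ⊙ α) ≃ (β ∘Π α)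
    ⊙≃∘Π = ≃-refl

    ⊙-cong : ∀ {A a b c a′ b′ c′} {α : ΠHom A a b} {β : ΠHom A b c}
             {α′ : ΠHom A a′ b′} {β′ : ΠHom A b′ c′} → β ≃ β′ → α ≃ α′ → (β ⊙ α) ≃ (β′ ⊙ α′)
    ⊙-cong eq eq′ = mk≃ (∘-resp-≈ (PO.unique _ (trans PO.copair-inl (maps-≈ eq′))
                                               (trans PO.copair-inr (maps-≈ eq))) refl)

    ⊙-identityˡ : ∀ {A a b} {α : ΠHom A a b} → (Πid ⊙ α) ≃ α
    ⊙-identityˡ {α = α} = mk≃ (Π-identityˡ {α = α})

    ⊙-identityʳ : ∀ {A a b} {α : ΠHom A a b} → (α ⊙ Πid) ≃ α
    ⊙-identityʳ {α = α} = mk≃ (Π-identityʳ {α = α})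

    ⊙-inverseˡ : ∀ {A a b} {α : ΠHom A a b} → (Πinv α ⊙ α) ≃ Πid {a = a}
    ⊙-inverseˡ {α = α} = mk≃ (Π-inverseˡ {α = α})

    ⊙-inverseʳ : ∀ {A a b} {α : ΠHom A a b} → (α ⊙ Πinv α) ≃ Πid {a = b}
    ⊙-inverseʳ {α = α} = mk≃ (Π-inverseʳ {α = α})

    ⊙-assoc : ∀ {A a b c d} {α : ΠHom A a b} {β : ΠHom A b c} {γ : ΠHom A c d} →
              ((γ ⊙ β) ⊙ α) ≃ (γ ⊙ (β ⊙ α))
    ⊙-assoc {α = α} {β} {γ} = mk≃ (Π-assoc {α = α} {β} {γ})

  Π≃ : Obj → Groupoid ℓ (ℓ ⊔ e) e
  Π≃ A = record
    { category = record
      { Obj = Hom I₀ A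
      ; Hom = ΠHom A
      ; _≈_ = _≃_
      ; id = Πid
      ; _∘_ = _⊙_
      ; equiv = record { refl = ≃-refl ; sym = ≃-sym ; trans = ≃-trans }
      ; assoc = ⊙-assoc
      ; identityˡ = ⊙-identityˡ
      ; identityʳ = ⊙-identityʳ
      ; ∘-resp-≈ = ⊙-cong
      }
    ; _⁻¹ = Πinv
    ; inverseˡ = ⊙-inverseˡ
    ; inverseʳ = ⊙-inverseʳ
    }

  module Π≃ {A} = GroupoidProperties (Π≃ A)

  module _ {o′ ℓ′ e′} {C : Category o′ ℓ′ e′} {A : Obj} (F : Functor C (ΠC A)) where
    open Functor F

    ΠF-homomorphism : ∀ {X Y Z} {f : Category.Hom C X Y} {g : Category.Hom C Y Z} →
                      F₁ (Category._∘_ C g f) ≃ (F₁ g ⊙ F₁ f)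
    ΠF-homomorphism = ≃-trans (mk≃ homomorphism) (≃-sym ⊙≃∘Π)

  castΠ : ∀ {A a b a′ b′} → ΠHom A a b → a ≈ a′ → b ≈ b′ → ΠHom A a′ b′
  castΠ α eq eq′ = path (map α) (trans (src α) eq) (trans (tgt α) eq′)

  castΠ-≃ : ∀ {A a b a′ b′} {α : ΠHom A a b} {eq : a ≈ a′} {eq′ : b ≈ b′} → castΠ α eq eq′ ≃ α
  castΠ-≃ = mk≃ refl

  Πid-cong : ∀ {A} {a a′ : Hom I₀ A} → a ≈ a′ → Πid {A} {a} ≃ Πid {A} {a′}
  Πid-cong eq = mk≃ (∘-resp-≈ eq refl)

  Πinv-Πid : ∀ {A a} → Πinv (Πid {A} {a}) ≃ Πid {A} {a}
  Πinv-Πid = mk≃ (trans assoc (∘-resp-≈ refl (!-unique₂ _ _)))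

  Πmap-cong : ∀ {A B a b a′ b′} (u : Hom A B) {α : ΠHom A a b} {β : ΠHom A a′ b′} →
              α ≃ β → Functor.F₁ (Πmap u) α ≃ Functor.F₁ (Πmap u) β
  Πmap-cong u eq = mk≃ (∘-resp-≈ refl (maps-≈ eq))

  Πmap-⊙ : ∀ {A B a b c} (u : Hom A B) {α : ΠHom A a b} {β : ΠHom A b c} →
           Functor.F₁ (Πmap u) (β ⊙ α) ≃ (Functor.F₁ (Πmap u) β ⊙ Functor.F₁ (Πmap u) α)
  Πmap-⊙ u {α} {β} = ≃-trans (Πmap-cong u ⊙≃∘Π) (ΠF-homomorphism (Πmap u) {f = α} {g = β})

  module _ {C A : Obj} where

    ⟨_,_⟩Π : ∀ {c c′ a a′} → ΠHom C c c′ → ΠHom A a a′ → ΠHom (C ×₀ A) prod.⟨ c , a ⟩ prod.⟨ c′ , a′ ⟩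
    ⟨ p , α ⟩Π = path prod.⟨ map p , map α ⟩ (trans ⟨⟩∘ (⟨⟩-cong₂ (src p) (src α)))
                                              (trans ⟨⟩∘ (⟨⟩-cong₂ (tgt p) (tgt α)))

    ⟨⟩Π-cong : ∀ {c c′ a a′ d d′ b b′} {p : ΠHom C c c′} {p′ : ΠHom C d d′}
               {α : ΠHom A a a′} {α′ : ΠHom A b b′} → p ≃ p′ → α ≃ α′ → ⟨ p , α ⟩Π ≃ ⟨ p′ , α′ ⟩Π
    ⟨⟩Π-cong eq eq′ = mk≃ (⟨⟩-cong₂ (maps-≈ eq) (maps-≈ eq′))

    opaque
      unfolding _⊙_

      ⟨⟩Π-⊙ : ∀ {c c′ c″ a a′ a″} {p : ΠHom C c c′} {p′ : ΠHom C c′ c″}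
              {α : ΠHom A a a′} {α′ : ΠHom A a′ a″} →
              (⟨ p′ , α′ ⟩Π ⊙ ⟨ p , α ⟩Π) ≃ ⟨ p′ ⊙ p , α′ ⊙ α ⟩Π
      ⟨⟩Π-⊙ = mk≃ (trans (∘-resp-≈ (sym (PO.unique _ (trans ⟨⟩∘ (⟨⟩-cong₂ PO.copair-inl PO.copair-inl))
                                                     (trans ⟨⟩∘ (⟨⟩-cong₂ PO.copair-inr PO.copair-inr))))
                                   refl)
                        ⟨⟩∘)

    ⟨⟩Π-Πinv : ∀ {c c′ a a′} {p : ΠHom C c c′} {α : ΠHom A a a′} →
               Πinv ⟨ p , α ⟩Π ≃ ⟨ Πinv p , Πinv α ⟩Π
    ⟨⟩Π-Πinv = mk≃ ⟨⟩∘

  module _ {C A B : Obj} (u : Hom (C ×₀ A) B) where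

    Π₂ : ∀ {c c′ a a′} → ΠHom C c c′ → ΠHom A a a′ →
         ΠHom B (u ∘ prod.⟨ c , a ⟩) (u ∘ prod.⟨ c′ , a′ ⟩)
    Π₂ p α = Functor.F₁ (Πmap u) ⟨ p , α ⟩Π

    Π₂-cong : ∀ {c c′ a a′ d d′ b b′} {p : ΠHom C c c′} {p′ : ΠHom C d d′}
              {α : ΠHom A a a′} {α′ : ΠHom A b b′} → p ≃ p′ → α ≃ α′ → Π₂ p α ≃ Π₂ p′ α′
    Π₂-cong eq eq′ = Πmap-cong u (⟨⟩Π-cong eq eq′)

    Π₂-⊙ : ∀ {c c′ c″ a a′ a″} {p : ΠHom C c c′} {p′ : ΠHom C c′ c″}
           {α : ΠHom A a a′} {α′ : ΠHom A a′ a″} → (Π₂ p′ α′ ⊙ Π₂ p α) ≃ Π₂ (p′ ⊙ p) (α′ ⊙ α)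
    Π₂-⊙ = ≃-trans (≃-sym (Πmap-⊙ u)) (Πmap-cong u ⟨⟩Π-⊙)

    Π₂-Πid : ∀ {c a} → Π₂ (Πid {C} {c}) (Πid {A} {a}) ≃ Πid
    Π₂-Πid = mk≃ (trans (∘-resp-≈ refl (sym ⟨⟩∘)) (sym assoc))

    Π₂-Πinv : ∀ {c c′ a a′} {p : ΠHom C c c′} {α : ΠHom A a a′} → Πinv (Π₂ p α) ≃ Π₂ (Πinv p) (Πinv α)
    Π₂-Πinv {p = p} {α} = mk≃ (trans assoc (∘-resp-≈ refl (maps-≈ (⟨⟩Π-Πinv {p = p} {α}))))

    Π₂-factor : ∀ {c c′ a a′} {p : ΠHom C c c′} {α : ΠHom A a a′} →
                (Π₂ p Πid ⊙ Π₂ Πid α) ≃ Π₂ p α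
    Π₂-factor = ≃-trans Π₂-⊙ (Π₂-cong ⊙-identityʳ ⊙-identityˡ)

    Π₂-interchange : ∀ {c c′ a a′} {p : ΠHom C c c′} {α : ΠHom A a a′} →
                     (Π₂ p Πid ⊙ Π₂ Πid α) ≃ (Π₂ Πid α ⊙ Π₂ p Πid)
    Π₂-interchange = ≃-trans Π₂-factor (≃-sym (≃-trans Π₂-⊙ (Π₂-cong ⊙-identityˡ ⊙-identityʳ)))

  Π₂-λg : ∀ {C A B c c′ a a′} {k : Hom (C ×₀ A) B} {p : ΠHom C c c′} {α : ΠHom A a a′} →
          Π₂ eval (Functor.F₁ (Πmap (λg k)) p) α ≃ Π₂ k p α
  Π₂-λg = mk≃ eval-λg-pointwise

  module _ {o′ ℓ′ e′} {C : Category o′ ℓ′ e′} {B : Obj} {F G : Functor C (ΠC B)} where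
    private
      module C = Category C
      module F = Functor F
      module G = Functor G

    natIsoΠ : (η : ∀ X → ΠHom B (F.F₀ X) (G.F₀ X)) →
              (∀ {X Y} (f : C.Hom X Y) → (η Y ⊙ F.F₁ f) ≃ (G.F₁ f ⊙ η X)) → NatIso F G
    natIsoΠ η natural = record
      { η = η
      ; η⁻¹ = λ X → Πinv (η X)
      ; isoˡ = λ {X} → Π-inverseˡ {α = η X}
      ; isoʳ = λ {X} → Π-inverseʳ {α = η X}
      ; commute = λ f → maps-≈ (≃-trans (≃-sym ⊙≃∘Π) (≃-trans (natural f) ⊙≃∘Π))
      }

    natIsoΠ-natural : (ε : NatIso F G) → ∀ {X Y} (f : C.Hom X Y) →
                      (NatIso.η ε Y ⊙ F.F₁ f) ≃ (G.F₁ f ⊙ NatIso.η ε X)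
    natIsoΠ-natural ε f = ≃-trans ⊙≃∘Π (≃-trans (mk≃ (NatIso.commute ε f)) (≃-sym ⊙≃∘Π))

    natIsoΠ-≃ : (∀ X → F.F₀ X ≈ G.F₀ X) → (∀ {X Y} (f : C.Hom X Y) → F.F₁ f ≃ G.F₁ f) → NatIso F G
    natIsoΠ-≃ F≈G F₁≃G₁ = natIsoΠ η λ {X} {Y} f → begin
      η Y ⊙ F.F₁ f  ≃⟨ ⊙-cong castΠ-≃ ≃-refl ⟩
      Πid ⊙ F.F₁ f  ≃⟨ ⊙-identityˡ ⟩
      F.F₁ f        ≃⟨ F₁≃G₁ f ⟩
      G.F₁ f        ≃˘⟨ ⊙-identityʳ ⟩
      G.F₁ f ⊙ Πid  ≃˘⟨ ⊙-cong ≃-refl (≃-trans castΠ-≃ (Πid-cong (F≈G X))) ⟩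
      G.F₁ f ⊙ η X  ∎
      where
        open ≃-Reasoning
        η : ∀ X → ΠHom B (F.F₀ X) (G.F₀ X)
        η X = castΠ Πid refl (F≈G X)

  module _ {o′ ℓ′ e′} {C : Category o′ ℓ′ e′} {A B : Obj} where

    ⟨_,_⟩ΠF : Functor C (ΠC A) → Functor C (ΠC B) → Functor C (ΠC (A ×₀ B))
    ⟨ F , G ⟩ΠF = record
      { F₀ = λ X → prod.⟨ F.F₀ X , G.F₀ X ⟩
      ; F₁ = λ f → ⟨ F.F₁ f , G.F₁ f ⟩Π
      ; identity = trans (⟨⟩-cong₂ F.identity G.identity) (sym ⟨⟩∘)
      ; homomorphism = maps-≈ (≃-trans (⟨⟩Π-cong (ΠF-homomorphism F) (ΠF-homomorphism G))
                                        (≃-trans (≃-sym ⟨⟩Π-⊙) ⊙≃∘Π))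
      ; F-resp-≈ = λ eq → ⟨⟩-cong₂ (F.F-resp-≈ eq) (G.F-resp-≈ eq)
      }
      where
        module F = Functor F
        module G = Functor G

module Assemblies {o ℓ e} (c : Level) (RC : RealizerCategory o ℓ e) where
  open PGAsm c RC
  open RealizerCategory RC
  open Category R
  open Equiv
  open CartesianClosed ccc using (!; module prod; _×₀_; _^_; eval; λg) renaming (⊤ to 𝟙)
  open Interval 𝕀 using (ΠHom; Πid; _∘Π_; Πinv; _≈Π_)
  open IntervalData (Interval.intervalData 𝕀) using (I₀)
  open RealizerProperties RC

  terminal : TerminalObj
  terminal = record
    { ⊤ = ⊤ₐ
    ; ! = λ _ → record
      { F = record { F₀ = λ _ → tt ; F₁ = λ _ → tt ; identity = tt ; homomorphism = tt ; F-resp-≈ = λ _ → tt }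
      ; tracker = !
      ; ε = natIsoΠ-≃ (λ _ → !-unique₂ _ _) (λ _ → mk≃ (!-unique₂ _ _))
      }
    ; !-unique = λ _ _ → record { eq₀ = λ _ → P.refl ; eq₁ = λ _ → tt }
    }
    where
      ⊤ₐ : Ob
      ⊤ₐ = record
        { X = unit-groupoid
        ; A = 𝟙
        ; ‖_‖ = record
          { F₀ = λ _ → ! ; F₁ = λ _ → Πid ; identity = refl ; homomorphism = !-unique₂ _ _ ; F-resp-≈ = λ _ → refl }
        }

  infixr 7 _⊗_
  _⊗_ : Ob → Ob → Ob
  𝒳 ⊗ 𝒴 = record
    { X = Ob.X 𝒳 ×G Ob.X 𝒴
    ; A = Ob.A 𝒳 ×₀ Ob.A 𝒴
    ; ‖_‖ = ⟨ Ob.‖_‖ 𝒳 ∘F π₁F , Ob.‖_‖ 𝒴 ∘F π₂F ⟩ΠF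
    }

  module _ {𝒳 𝒴 : Ob} where
    private
      module 𝒳 = Ob 𝒳
      module 𝒴 = Ob 𝒴

    π₁ₐ : Mor (𝒳 ⊗ 𝒴) 𝒳
    π₁ₐ = record
      { F = π₁F ; tracker = prod.π₁ ; ε = natIsoΠ-≃ (λ _ → prod.project₁) (λ _ → mk≃ prod.project₁) }

    π₂ₐ : Mor (𝒳 ⊗ 𝒴) 𝒴
    π₂ₐ = record
      { F = π₂F ; tracker = prod.π₂ ; ε = natIsoΠ-≃ (λ _ → prod.project₂) (λ _ → mk≃ prod.project₂) }

    ⟨_,_⟩ₐ : ∀ {𝒵} → Mor 𝒵 𝒳 → Mor 𝒵 𝒴 → Mor 𝒵 (𝒳 ⊗ 𝒴)
    ⟨_,_⟩ₐ {𝒵} K₁ K₂ = record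
      { F = ⟨ K₁.F , K₂.F ⟩F
      ; tracker = t
      ; ε = natIsoΠ η natural
      }
      where
        module K₁ = Mor K₁
        module K₂ = Mor K₂
        open Functor (Ob.‖_‖ 𝒵) using () renaming (F₀ to ‖_‖₀; F₁ to ‖_‖₁)
        open Functor (𝒳.‖_‖ ∘F K₁.F) using () renaming (F₀ to ‖K₁‖₀; F₁ to ‖K₁‖₁)
        open Functor (𝒴.‖_‖ ∘F K₂.F) using () renaming (F₀ to ‖K₂‖₀; F₁ to ‖K₂‖₁)
        open NatIso K₁.ε using () renaming (η to ε₁)
        open NatIso K₂.ε using () renaming (η to ε₂)

        t : Hom (Ob.A 𝒵) (𝒳.A ×₀ 𝒴.A)
        t = prod.⟨ K₁.tracker , K₂.tracker ⟩

        η : ∀ z → ΠHom (𝒳.A ×₀ 𝒴.A) (t ∘ ‖ z ‖₀) prod.⟨ ‖K₁‖₀ z , ‖K₂‖₀ z ⟩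
        η z = castΠ ⟨ ε₁ z , ε₂ z ⟩Π (sym ⟨⟩∘) refl

        natural : ∀ {z z′} (f : Category.Hom (Ob.Cat 𝒵) z z′) →
                  (η z′ ⊙ Functor.F₁ (Πmap t) ‖ f ‖₁) ≃ (⟨ ‖K₁‖₁ f , ‖K₂‖₁ f ⟩Π ⊙ η z)
        natural {z} {z′} f = begin
          η z′ ⊙ Functor.F₁ (Πmap t) ‖ f ‖₁
            ≃⟨ ⊙-cong castΠ-≃ (mk≃ ⟨⟩∘) ⟩
          ⟨ ε₁ z′ , ε₂ z′ ⟩Π ⊙ ⟨ Functor.F₁ (Πmap K₁.tracker) ‖ f ‖₁ , Functor.F₁ (Πmap K₂.tracker) ‖ f ‖₁ ⟩Π
            ≃⟨ ⟨⟩Π-⊙ ⟩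
          ⟨ ε₁ z′ ⊙ Functor.F₁ (Πmap K₁.tracker) ‖ f ‖₁ , ε₂ z′ ⊙ Functor.F₁ (Πmap K₂.tracker) ‖ f ‖₁ ⟩Π
            ≃⟨ ⟨⟩Π-cong (natIsoΠ-natural K₁.ε f) (natIsoΠ-natural K₂.ε f) ⟩
          ⟨ ‖K₁‖₁ f ⊙ ε₁ z , ‖K₂‖₁ f ⊙ ε₂ z ⟩Π
            ≃˘⟨ ⟨⟩Π-⊙ ⟩
          ⟨ ‖K₁‖₁ f , ‖K₂‖₁ f ⟩Π ⊙ ⟨ ε₁ z , ε₂ z ⟩Π
            ≃˘⟨ ⊙-cong ≃-refl castΠ-≃ ⟩
          ⟨ ‖K₁‖₁ f , ‖K₂‖₁ f ⟩Π ⊙ η z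
            ∎
          where open ≃-Reasoning

  binaryProduct : ∀ 𝒳 𝒴 → BinaryProduct 𝒳 𝒴
  binaryProduct 𝒳 𝒴 = record
    { obj = 𝒳 ⊗ 𝒴
    ; π₁ = π₁ₐ
    ; π₂ = π₂ₐ
    ; ⟨_,_⟩ = ⟨_,_⟩ₐ
    ; project₁ = λ K₁ K₂ → π₁F∘⟨⟩F (Mor.F K₁) (Mor.F K₂)
    ; project₂ = λ K₁ K₂ → π₂F∘⟨⟩F (Mor.F K₁) (Mor.F K₂)
    ; unique = λ K₁ K₂ H → ⟨⟩F-unique (Mor.F H)
    }

  module Exponential (𝒳 𝒴 : Ob) where
    private
      module 𝒳 = Ob 𝒳
      module 𝒴 = Ob 𝒴
      module X‖ = Functor 𝒳.‖_‖
      module Y‖ = Functor 𝒴.‖_‖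
      module XC = Category 𝒳.Cat
      module YC = Category 𝒴.Cat
      module YG = GroupoidProperties 𝒴.X
    open Groupoid 𝒴.X using (_⁻¹)

    Bᴬ : Obj
    Bᴬ = 𝒴.A ^ 𝒳.A

    evalΠ : ∀ {t t′ a a′} → ΠHom Bᴬ t t′ → ΠHom 𝒳.A a a′ →
            ΠHom 𝒴.A (eval ∘ prod.⟨ t , a ⟩) (eval ∘ prod.⟨ t′ , a′ ⟩)
    evalΠ = Π₂ eval

    Πapply : Hom I₀ Bᴬ → Functor (ΠC 𝒳.A) (ΠC 𝒴.A)
    Πapply t = record
      { F₀ = λ a → eval ∘ prod.⟨ t , a ⟩
      ; F₁ = evalΠ Πid
      ; identity = maps-≈ (Π₂-Πid eval)
      ; homomorphism = λ {_ _ _ α β} → maps-≈ (begin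
          evalΠ Πid (β ∘Π α)             ≃⟨ Π₂-cong eval (≃-sym ⊙-identityˡ) (≃-sym ⊙≃∘Π) ⟩
          evalΠ (Πid ⊙ Πid) (β ⊙ α)      ≃˘⟨ Π₂-⊙ eval ⟩
          evalΠ Πid β ⊙ evalΠ Πid α      ≃⟨ ⊙≃∘Π ⟩
          evalΠ Πid β ∘Π evalΠ Πid α     ∎)
      ; F-resp-≈ = λ {_ _ α α′} eq → maps-≈ (Π₂-cong eval {p = Πid {a = t}} {Πid} {α} {α′} ≃-refl (mk≃ eq))
      }
      where open ≃-Reasoning

    record TrackedFunctor : Set κ where
      field
        functor  : Functor 𝒳.Cat 𝒴.Cat
        code     : Hom I₀ Bᴬ
        tracking : NatIso (Πapply code ∘F 𝒳.‖_‖) (𝒴.‖_‖ ∘F functor)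
      open Functor functor public using (F₀; F₁)

      τ : ∀ x → ΠHom 𝒴.A (eval ∘ prod.⟨ code , X‖.F₀ x ⟩) (Y‖.F₀ (F₀ x))
      τ = NatIso.η tracking

      τ-natural : ∀ {x x′} (g : XC.Hom x x′) → (τ x′ ⊙ evalΠ Πid (X‖.F₁ g)) ≃ (Y‖.F₁ (F₁ g) ⊙ τ x)
      τ-natural = natIsoΠ-natural tracking
    open TrackedFunctor

    record TrackedTransformation (s s′ : TrackedFunctor) : Set κ where
      field
        codePath  : ΠHom Bᴬ (code s) (code s′)
        component : ∀ x → YC.Hom (F₀ s x) (F₀ s′ x)
        natural   : ∀ {x x′} (g : XC.Hom x x′) → component x′ YC.∘ F₁ s g YC.≈ F₁ s′ g YC.∘ component x
        coherent  : ∀ x → (Y‖.F₁ (component x) ⊙ τ s x) ≃ (τ s′ x ⊙ evalΠ codePath Πid)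
    open TrackedTransformation

    _≈ₜ_ : ∀ {s s′} (h h′ : TrackedTransformation s s′) → Set κ
    h ≈ₜ h′ = (codePath h ≃ codePath h′) × (∀ x → component h x YC.≈ component h′ x)

    evalΠ-⊙ : ∀ {t t′ t″ a} {p : ΠHom Bᴬ t t′} {p′ : ΠHom Bᴬ t′ t″} →
               (evalΠ p′ (Πid {a = a}) ⊙ evalΠ p Πid) ≃ evalΠ (p′ ⊙ p) Πid
    evalΠ-⊙ = ≃-trans (Π₂-⊙ eval) (Π₂-cong eval ≃-refl ⊙-identityˡ)

    evalΠ-Πinv : ∀ {t t′ a} {p : ΠHom Bᴬ t t′} → Πinv (evalΠ p (Πid {a = a})) ≃ evalΠ (Πinv p) Πid
    evalΠ-Πinv = ≃-trans (Π₂-Πinv eval) (Π₂-cong eval ≃-refl Πinv-Πid)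

    idₜ : ∀ {s} → TrackedTransformation s s
    idₜ {s} = record
      { codePath = Πid
      ; component = λ _ → YC.id
      ; natural = λ _ → YC.Equiv.trans YC.identityˡ (YC.Equiv.sym YC.identityʳ)
      ; coherent = λ x → begin
          Y‖.F₁ YC.id ⊙ τ s x    ≃⟨ ⊙-cong (mk≃ Y‖.identity) ≃-refl ⟩
          Πid ⊙ τ s x            ≃⟨ ⊙-identityˡ ⟩
          τ s x                  ≃˘⟨ ⊙-identityʳ ⟩
          τ s x ⊙ Πid            ≃˘⟨ ⊙-cong ≃-refl (Π₂-Πid eval) ⟩
          τ s x ⊙ evalΠ Πid Πid  ∎
      }
      where open ≃-Reasoning

    _∘ₜ_ : ∀ {s s′ s″} → TrackedTransformation s′ s″ → TrackedTransformation s s′ → TrackedTransformation s s″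
    _∘ₜ_ {s} {s′} {s″} h′ h = record
      { codePath = codePath h′ ⊙ codePath h
      ; component = λ x → component h′ x YC.∘ component h x
      ; natural = λ g → YG.paste-squares (natural h g) (natural h′ g)
      ; coherent = λ x → begin
          Y‖.F₁ (component h′ x YC.∘ component h x) ⊙ τ s x
            ≃⟨ ⊙-cong (ΠF-homomorphism 𝒴.‖_‖) ≃-refl ⟩
          (Y‖.F₁ (component h′ x) ⊙ Y‖.F₁ (component h x)) ⊙ τ s x
            ≃⟨ Π≃.paste-squares (coherent h x) (coherent h′ x) ⟩
          τ s″ x ⊙ (evalΠ (codePath h′) Πid ⊙ evalΠ (codePath h) Πid)
            ≃⟨ ⊙-cong ≃-refl evalΠ-⊙ ⟩
          τ s″ x ⊙ evalΠ (codePath h′ ⊙ codePath h) Πid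
            ∎
      }
      where open ≃-Reasoning

    _⁻¹ₜ : ∀ {s s′} → TrackedTransformation s s′ → TrackedTransformation s′ s
    _⁻¹ₜ {s} {s′} h = record
      { codePath = Πinv (codePath h)
      ; component = λ x → component h x ⁻¹
      ; natural = λ g → YG.inverse-square (natural h g)
      ; coherent = λ x → begin
          Y‖.F₁ (component h x ⁻¹) ⊙ τ s′ x
            ≃⟨ ⊙-cong (mk≃ (F₁-inverse {G = 𝒴.X} {Π 𝒴.A} 𝒴.‖_‖)) ≃-refl ⟩
          Πinv (Y‖.F₁ (component h x)) ⊙ τ s′ x
            ≃⟨ Π≃.inverse-square (coherent h x) ⟩
          τ s x ⊙ Πinv (evalΠ (codePath h) Πid)
            ≃⟨ ⊙-cong ≃-refl evalΠ-Πinv ⟩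
          τ s x ⊙ evalΠ (Πinv (codePath h)) Πid
            ∎
      }
      where open ≃-Reasoning

    exponential-groupoid : Groupoid κ κ κ
    exponential-groupoid = record
      { category = record
        { Obj = TrackedFunctor
        ; Hom = TrackedTransformation
        ; _≈_ = _≈ₜ_
        ; id = idₜ
        ; _∘_ = _∘ₜ_
        ; equiv = record
          { refl = ≃-refl , λ _ → YC.Equiv.refl
          ; sym = λ eq → ≃-sym (proj₁ eq) , λ x → YC.Equiv.sym (proj₂ eq x)
          ; trans = λ eq eq′ → ≃-trans (proj₁ eq) (proj₁ eq′) , λ x → YC.Equiv.trans (proj₂ eq x) (proj₂ eq′ x)
          }
        ; assoc = ⊙-assoc , λ _ → YC.assoc
        ; identityˡ = ⊙-identityˡ , λ _ → YC.identityˡ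
        ; identityʳ = ⊙-identityʳ , λ _ → YC.identityʳ
        ; ∘-resp-≈ = λ eq eq′ → ⊙-cong (proj₁ eq) (proj₁ eq′) , λ x → YC.∘-resp-≈ (proj₂ eq x) (proj₂ eq′ x)
        }
      ; _⁻¹ = _⁻¹ₜ
      ; inverseˡ = ⊙-inverseˡ , λ _ → Groupoid.inverseˡ 𝒴.X
      ; inverseʳ = ⊙-inverseʳ , λ _ → Groupoid.inverseʳ 𝒴.X
      }

    Exp : Ob
    Exp = record
      { X = exponential-groupoid
      ; A = Bᴬ
      ; ‖_‖ = record
        { F₀ = code ; F₁ = codePath ; identity = refl ; homomorphism = maps-≈ ⊙≃∘Π ; F-resp-≈ = λ eq → maps-≈ (proj₁ eq) }
      }

    Exp-modest : Modest 𝒴 → Modest Exp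
    Exp-modest 𝒴-modest = record { full = full ; faithful = faithful }
      where
        module 𝒴-modest = FullyFaithful 𝒴-modest
        open ≃-Reasoning

        faithful : ∀ {s s′} (h h′ : TrackedTransformation s s′) → codePath h ≈Π codePath h′ → h ≈ₜ h′
        faithful {s} {s′} h h′ eq = mk≃ eq , λ x → 𝒴-modest.faithful _ _ (maps-≈ (Π≃.cancelʳ (begin
          Y‖.F₁ (component h x) ⊙ τ s x    ≃⟨ coherent h x ⟩
          τ s′ x ⊙ evalΠ (codePath h) Πid   ≃⟨ ⊙-cong ≃-refl (Π₂-cong eval (mk≃ eq) ≃-refl) ⟩
          τ s′ x ⊙ evalΠ (codePath h′) Πid  ≃˘⟨ coherent h′ x ⟩
          Y‖.F₁ (component h′ x) ⊙ τ s x   ∎)))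

        full : ∀ {s s′} (q : ΠHom Bᴬ (code s) (code s′)) → Σ[ h ∈ TrackedTransformation s s′ ] codePath h ≈Π q
        full {s} {s′} q = record { codePath = q ; component = component′ ; natural = natural′ ; coherent = coherent′ }
                        , refl
          where
            conjugate : ∀ x → ΠHom 𝒴.A (Y‖.F₀ (F₀ s x)) (Y‖.F₀ (F₀ s′ x))
            conjugate x = τ s′ x ⊙ (evalΠ q Πid ⊙ Πinv (τ s x))

            component′ : ∀ x → YC.Hom (F₀ s x) (F₀ s′ x)
            component′ x = proj₁ (𝒴-modest.full (conjugate x))

            component′-≃ : ∀ x → Y‖.F₁ (component′ x) ≃ conjugate x
            component′-≃ x = mk≃ (proj₂ (𝒴-modest.full (conjugate x)))

            conjugate-natural : ∀ {x x′} (g : XC.Hom x x′) →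
                                (conjugate x′ ⊙ Y‖.F₁ (F₁ s g)) ≃ (Y‖.F₁ (F₁ s′ g) ⊙ conjugate x)
            conjugate-natural g = Π≃.paste-squares
              (Π≃.paste-squares (Π≃.inverse-square (τ-natural s g)) (Π₂-interchange eval {p = q} {α = X‖.F₁ g}))
              (τ-natural s′ g)

            natural′ : ∀ {x x′} (g : XC.Hom x x′) →
                       component′ x′ YC.∘ F₁ s g YC.≈ F₁ s′ g YC.∘ component′ x
            natural′ {x} {x′} g = 𝒴-modest.faithful _ _ (maps-≈ (begin
              Y‖.F₁ (component′ x′ YC.∘ F₁ s g)        ≃⟨ ΠF-homomorphism 𝒴.‖_‖ ⟩
              Y‖.F₁ (component′ x′) ⊙ Y‖.F₁ (F₁ s g)  ≃⟨ ⊙-cong (component′-≃ x′) ≃-refl ⟩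
              conjugate x′ ⊙ Y‖.F₁ (F₁ s g)           ≃⟨ conjugate-natural g ⟩
              Y‖.F₁ (F₁ s′ g) ⊙ conjugate x           ≃˘⟨ ⊙-cong ≃-refl (component′-≃ x) ⟩
              Y‖.F₁ (F₁ s′ g) ⊙ Y‖.F₁ (component′ x)  ≃˘⟨ ΠF-homomorphism 𝒴.‖_‖ ⟩
              Y‖.F₁ (F₁ s′ g YC.∘ component′ x)        ∎))

            coherent′ : ∀ x → (Y‖.F₁ (component′ x) ⊙ τ s x) ≃ (τ s′ x ⊙ evalΠ q Πid)
            coherent′ x = begin
              Y‖.F₁ (component′ x) ⊙ τ s x   ≃⟨ ⊙-cong (component′-≃ x) ≃-refl ⟩
              conjugate x ⊙ τ s x            ≃⟨ Π≃.inverse-cancelʳ ⟩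
              τ s′ x ⊙ evalΠ q Πid           ∎

    evalF : Functor (Ob.Cat (Exp ⊗ 𝒳)) 𝒴.Cat
    evalF = record
      { F₀ = λ w → F₀ (proj₁ w) (proj₂ w)
      ; F₁ = λ {w} {w′} m → component (proj₁ m) (proj₂ w′) YC.∘ F₁ (proj₁ w) (proj₂ m)
      ; identity = λ {w} → YC.Equiv.trans YC.identityˡ (Functor.identity (functor (proj₁ w)))
      ; homomorphism = λ {w} {_} {_} {m} {m′} →
          YC.Equiv.trans (YC.∘-resp-≈ YC.Equiv.refl (Functor.homomorphism (functor (proj₁ w))))
                         (YG.middle-square (natural (proj₁ m) (proj₂ m′)))
      ; F-resp-≈ = λ {w} {w′} eq → YC.∘-resp-≈ (proj₂ (proj₁ eq) (proj₂ w′)) (Functor.F-resp-≈ (functor (proj₁ w)) (proj₂ eq))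
      }

    evalₐ : Mor (Exp ⊗ 𝒳) 𝒴
    evalₐ = record { F = evalF ; tracker = eval ; ε = natIsoΠ (λ w → τ (proj₁ w) (proj₂ w)) natural′ }
      where
        open ≃-Reasoning
        natural′ : ∀ {w w′} (m : Category.Hom (Ob.Cat (Exp ⊗ 𝒳)) w w′) →
                   (τ (proj₁ w′) (proj₂ w′) ⊙ evalΠ (codePath (proj₁ m)) (X‖.F₁ (proj₂ m))) ≃
                   (Y‖.F₁ (Functor.F₁ evalF m) ⊙ τ (proj₁ w) (proj₂ w))
        natural′ {s , x} {s′ , x′} (h , g) = begin
          τ s′ x′ ⊙ evalΠ (codePath h) (X‖.F₁ g)
            ≃˘⟨ ⊙-cong ≃-refl (Π₂-factor eval) ⟩
          τ s′ x′ ⊙ (evalΠ (codePath h) Πid ⊙ evalΠ Πid (X‖.F₁ g))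
            ≃˘⟨ Π≃.paste-squares (≃-sym (τ-natural s g)) (coherent h x′) ⟩
          (Y‖.F₁ (component h x′) ⊙ Y‖.F₁ (F₁ s g)) ⊙ τ s x
            ≃˘⟨ ⊙-cong (ΠF-homomorphism 𝒴.‖_‖) ≃-refl ⟩
          Y‖.F₁ (component h x′ YC.∘ F₁ s g) ⊙ τ s x
            ∎

    module Curry {𝒵 : Ob} (K : Mor (𝒵 ⊗ 𝒳) 𝒴) where
      private
        module 𝒵 = Ob 𝒵
        module Z‖ = Functor 𝒵.‖_‖
        module ZC = Category 𝒵.Cat
        module K = Mor K
        module KF = Functor K.F

      k : Hom (𝒵.A ×₀ 𝒳.A) 𝒴.A
      k = K.tracker

      Πλk : Functor 𝒵.Cat (ΠC Bᴬ)
      Πλk = Πmap (λg k) ∘F 𝒵.‖_‖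

      K-at : ZC.Obj → Functor 𝒳.Cat 𝒴.Cat
      K-at z = record
        { F₀ = λ x → KF.F₀ (z , x)
        ; F₁ = λ g → KF.F₁ (ZC.id , g)
        ; identity = KF.identity
        ; homomorphism = YC.Equiv.trans (KF.F-resp-≈ (ZC.Equiv.sym ZC.identityˡ , XC.Equiv.refl)) KF.homomorphism
        ; F-resp-≈ = λ eq → KF.F-resp-≈ (ZC.Equiv.refl , eq)
        }

      τₖ : ∀ z x → ΠHom 𝒴.A (eval ∘ prod.⟨ λg k ∘ Z‖.F₀ z , X‖.F₀ x ⟩) (Y‖.F₀ (KF.F₀ (z , x)))
      τₖ z x = castΠ (NatIso.η K.ε (z , x)) (sym eval-λg-pointwise) refl

      curry₀ : ZC.Obj → TrackedFunctor
      curry₀ z = record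
        { functor = K-at z
        ; code = λg k ∘ Z‖.F₀ z
        ; tracking = natIsoΠ (τₖ z) natural′
        }
        where
          open ≃-Reasoning
          natural′ : ∀ {x x′} (g : XC.Hom x x′) →
                     (τₖ z x′ ⊙ evalΠ Πid (X‖.F₁ g)) ≃ (Y‖.F₁ (KF.F₁ (ZC.id , g)) ⊙ τₖ z x)
          natural′ {x} {x′} g = begin
            τₖ z x′ ⊙ evalΠ Πid (X‖.F₁ g)
              ≃˘⟨ ⊙-cong ≃-refl (Π₂-cong eval (mk≃ (Functor.identity Πλk)) ≃-refl) ⟩
            τₖ z x′ ⊙ evalΠ (Functor.F₁ Πλk ZC.id) (X‖.F₁ g)
              ≃⟨ ⊙-cong castΠ-≃ Π₂-λg ⟩
            NatIso.η K.ε (z , x′) ⊙ Π₂ k (Z‖.F₁ ZC.id) (X‖.F₁ g)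
              ≃⟨ natIsoΠ-natural K.ε (ZC.id , g) ⟩
            Y‖.F₁ (KF.F₁ (ZC.id , g)) ⊙ NatIso.η K.ε (z , x)
              ≃˘⟨ ⊙-cong ≃-refl castΠ-≃ ⟩
            Y‖.F₁ (KF.F₁ (ZC.id , g)) ⊙ τₖ z x
              ∎

      curry₁ : ∀ {z z′} → ZC.Hom z z′ → TrackedTransformation (curry₀ z) (curry₀ z′)
      curry₁ {z} {z′} f = record
        { codePath = Functor.F₁ Πλk f
        ; component = λ _ → KF.F₁ (f , XC.id)
        ; natural = λ g → YC.Equiv.trans (YC.Equiv.sym KF.homomorphism)
            (YC.Equiv.trans (KF.F-resp-≈ (ZC.Equiv.trans ZC.identityʳ (ZC.Equiv.sym ZC.identityˡ)
                                         , XC.Equiv.trans XC.identityˡ (XC.Equiv.sym XC.identityʳ)))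
                            KF.homomorphism)
        ; coherent = coherent′
        }
        where
          open ≃-Reasoning
          coherent′ : ∀ x → (Y‖.F₁ (KF.F₁ (f , XC.id)) ⊙ τₖ z x) ≃
                            (τₖ z′ x ⊙ evalΠ (Functor.F₁ Πλk f) Πid)
          coherent′ x = begin
            Y‖.F₁ (KF.F₁ (f , XC.id)) ⊙ τₖ z x
              ≃⟨ ⊙-cong ≃-refl castΠ-≃ ⟩
            Y‖.F₁ (KF.F₁ (f , XC.id)) ⊙ NatIso.η K.ε (z , x)
              ≃˘⟨ natIsoΠ-natural K.ε (f , XC.id) ⟩
            NatIso.η K.ε (z′ , x) ⊙ Π₂ k (Z‖.F₁ f) (X‖.F₁ XC.id)
              ≃˘⟨ ⊙-cong castΠ-≃ (≃-trans Π₂-λg (Π₂-cong k ≃-refl (mk≃ (sym X‖.identity)))) ⟩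
            τₖ z′ x ⊙ evalΠ (Functor.F₁ Πλk f) Πid
              ∎

      curryF : Functor 𝒵.Cat (Ob.Cat Exp)
      curryF = record
        { F₀ = curry₀
        ; F₁ = curry₁
        ; identity = mk≃ (Functor.identity Πλk) , λ _ → KF.identity
        ; homomorphism = ΠF-homomorphism Πλk
                       , λ _ → YC.Equiv.trans (KF.F-resp-≈ (ZC.Equiv.refl , XC.Equiv.sym XC.identityˡ)) KF.homomorphism
        ; F-resp-≈ = λ eq → mk≃ (Functor.F-resp-≈ Πλk eq) , λ _ → KF.F-resp-≈ (eq , XC.Equiv.refl)
        }

      curryₐ : Mor 𝒵 Exp
      curryₐ = record { F = curryF ; tracker = λg k ; ε = natIsoΠ-≃ (λ _ → refl) (λ _ → ≃-refl) }

      eval∘curry : (evalF ∘F ⟨ curryF ∘F π₁F , π₂F ⟩F) ≡F K.F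
      eval∘curry = record
        { eq₀ = λ _ → P.refl
        ; eq₁ = λ _ → YC.Equiv.trans (YC.Equiv.sym KF.homomorphism) (KF.F-resp-≈ (ZC.identityʳ , XC.identityˡ))
        }

    weakExponential : WeakExponential binaryProduct 𝒳 𝒴
    weakExponential = record
      { obj = Exp
      ; ev = evalₐ
      ; curry = Curry.curryₐ
      ; β = λ K h π₁h≡ π₂h≡ → ≡F-trans (∘F-resp-≡F evalF (⟨⟩F-unique (Mor.F h) π₁h≡ π₂h≡)) (Curry.eval∘curry K)
      }

  weaklyCartesianClosed : WeaklyCartesianClosed
  weaklyCartesianClosed = record
    { terminal = terminal
    ; product = binaryProduct
    ; exponential = Exponential.weakExponential
    }

mainTheorem3 : ∀ {o ℓ e} (c : Level) (RC : RealizerCategory o ℓ e) →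
    let open PGAsm c RC in
    Σ[ W ∈ WeaklyCartesianClosed ]
      (∀ 𝒳 𝒴 → Modest 𝒴 →
        Modest (WeakExponential.obj (WeaklyCartesianClosed.exponential W 𝒳 𝒴)))
mainTheorem3 c RC = weaklyCartesianClosed , Exponential.Exp-modest
  where open Assemblies c RC
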